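{- For each fixed integer $k\ge1$, as $n\to\infty$, $$P'(1,n,k)\sim n^{k-1},$$ where $P'(1,n,k)$ is the number of 1-ball prime passing patterns of period $n$ with $k$ hands.
   Context: A 1-ball passing state with $k$ hands is a $k\times\infty$ $\{0,1\}$-matrix $A=(a_{i,j})$ with exactly one entry equal to $1$ ($a_{i,j}=1$ means the ball lands at hand $i$ in $j$ beats). There is a transition $A\to B$ iff $a_{i,j+1}\le b_{i,j}$ for all $i$ and all $j\ge1$. A prime passing pattern of period $n$ is a directed cycle of length $n$ in this graph, counted up to cyclic rotation. -}

module Defs where

open import Data.Nat as ℕ using (ℕ; zero; suc; _≤_; _^_; _∸_; NonZero)
open import Data.Nat.DivMod using (_mod_)
open import Data.Fin as Fin using (Fin; toℕ)
open import Data.Fin.Properties as FinP using ()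
open import Data.Product using (Σ; _×_; _,_; ∃)
open import Data.List using (List; length)
open import Data.List.Relation.Unary.All using (All)
open import Data.List.Relation.Unary.Any using (Any)
open import Data.List.Relation.Unary.AllPairs using (AllPairs)
open import Data.Vec using (Vec; lookup; tabulate)
open import Data.Integer using (+_)
open import Data.Rational as ℚ using (ℚ; _/_; _<_; _*_; _-_; ∣_∣; 0ℚ)
open import Relation.Nullary using (¬_; yes; no)
open import Relation.Binary.PropositionalEquality using (_≡_; _≢_)

-- A 1-ball passing state with k hands: a k×∞ {0,1}-matrix with exactly one
-- entry equal to 1.  Such a matrix is determined by the position of its
-- unique 1-entry; the pair (i , m) stands for the matrix whose only 1 is at
-- row i, column (suc m)  (columns are indexed by j ≥ 1).
State : ℕ → Set
State k = Fin k × ℕ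

entry : ∀ {k} → State k → Fin k → ℕ → ℕ
entry (i , m) i' j with i Fin.≟ i' | suc m ℕ.≟ j
... | yes _ | yes _ = 1
... | _     | _     = 0

_⟶_ : ∀ {k} → State k → State k → Set
_⟶_ {k} A B = (i : Fin k) (j : ℕ) → 1 ≤ j → entry A i (suc j) ≤ entry B i j

_⊕_ : ∀ {n} .{{_ : NonZero n}} → Fin n → Fin n → Fin n
_⊕_ {n} a b = (toℕ a ℕ.+ toℕ b) mod n

next : ∀ {n} .{{_ : NonZero n}} → Fin n → Fin n
next {n} t = (suc (toℕ t)) mod n

IsCycle : ∀ {k n} .{{_ : NonZero n}} → Vec (State k) n → Set
IsCycle {k} {n} s =
  ((t u : Fin n) → lookup s t ≡ lookup s u → t ≡ u)
  × ((t : Fin n) → lookup s t ⟶ lookup s (next t))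

rot : ∀ {A : Set} {n} .{{_ : NonZero n}} → Fin n → Vec A n → Vec A n
rot r s = tabulate (λ t → lookup s (r ⊕ t))

RotEquiv : ∀ {A : Set} {n} .{{_ : NonZero n}} → Vec A n → Vec A n → Set
RotEquiv {n = n} s s' = ∃ λ (r : Fin n) → s' ≡ rot r s

-- PrimeCount k n c : the number of 1-ball prime passing patterns of period n
-- with k hands (directed cycles of length n, counted up to cyclic rotation)
-- equals c.
PrimeCount : (k n : ℕ) .{{_ : NonZero n}} → ℕ → Set
PrimeCount k n c =
  Σ (List (Vec (State k) n)) λ L →
      length L ≡ c
    × All IsCycle L
    × AllPairs (λ s s' → ¬ RotEquiv s s') L
    × ((s : Vec (State k) n) → IsCycle s → Any (RotEquiv s) L)

ℕtoℚ : ℕ → ℚ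
ℕtoℚ n = + n / 1

_∼_ : (ℕ → ℕ) → (ℕ → ℕ) → Set
f ∼ g = (ε : ℚ) → 0ℚ < ε → ∃ λ N → (n : ℕ) → N ≤ n →
          ∣ ℕtoℚ (f n) - ℕtoℚ (g n) ∣ < ε * ℕtoℚ (g n)

{-# OPTIONS --safe #-}
module Submission where

-- A state (i , m) with m > 0 has exactly one successor, (i , m ∸ 1), while a
-- state (i , 0) may pass to any state.  A cycle is therefore a cyclic sequence
-- of throws: a throw to hand i of height h + 1 contributes the states
-- (i , h), (i , h ∸ 1), …, (i , 0), and since states do not repeat, no hand is
-- thrown to twice.  Rotating the cycle so that it starts at the highest state
-- of its smallest hand picks one representative per rotation class: a first
-- throw to some hand a, followed by throws to distinct hands larger than a
-- taking at most n ∸ 1 beats, the first throw filling the remaining beats.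
-- Hence P′(1,n,k) = Σ_{j<k} countUpTo j (n ∸ 1), where countUpTo j L counts
-- the sequences of throws to distinct hands among j given ones that take at
-- most L beats.  Since (L + 1)(L)⋯(L + 2 ∸ j) ≤ countUpTo j L ≤ (L + 1)^j,
-- only the term j = k ∸ 1 is of order n^(k ∸ 1), and it is n^(k ∸ 1) up to
-- O(n^(k ∸ 2)).

open import Defs
open import Data.Empty using (⊥)
open import Data.Fin as Fin using (Fin; toℕ)
import Data.Fin.Properties as Fin
open import Data.List using (List; []; _∷_; _++_; map; concatMap; filter; allFin; length)
open import Data.List.Extrema.Nat using (argmin; argmax; f[argmin]≤f[xs]; f[xs]≤f[argmax]; argmax-all)
open import Data.List.Membership.Propositional using (_∈_; find; lose)
open import Data.List.Membership.Propositional.Properties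
  using (∈-allFin; ∈-filter⁺; ∈-filter⁻; ∈-map⁺; ∈-map⁻; ∈-++⁺ˡ; ∈-++⁺ʳ; ∈-++⁻;
         ∈-concatMap⁺; ∈-concatMap⁻)
open import Data.List.Properties
  using (length-++; length-map; length-tabulate; ∷-injectiveˡ; ∷-injectiveʳ; filter-all)
open import Data.List.Relation.Binary.Disjoint.Propositional using (Disjoint)
open import Data.List.Relation.Binary.Subset.Propositional using (_⊆_)
open import Data.List.Relation.Unary.All as All using (All; []; _∷_)
import Data.List.Relation.Unary.All.Properties as All
import Data.List.Relation.Unary.AllPairs as AllPairs
import Data.List.Relation.Unary.AllPairs.Properties as AllPairs
open import Data.List.Relation.Unary.Any using (Any; here; there)
import Data.List.Relation.Unary.Any.Properties as Any
open import Data.List.Relation.Unary.Unique.Propositional using (Unique; []; _∷_)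
import Data.List.Relation.Unary.Unique.Propositional.Properties as Unique
open import Data.Nat as ℕ
  using (ℕ; zero; suc; _+_; _*_; _∸_; _^_; _≤_; _<_; z≤n; s≤s; ∣_-_∣; NonZero; >-nonZero)
open import Data.Nat.Combinatorics.Base using () renaming (_P′_ to _↓_)
open import Data.Nat.Combinatorics.Specification using (nP′k≡n[n∸1P′k∸1])
open import Data.Nat.Coprimality as Coprime using (Coprime; 1-coprimeTo)
open import Data.Nat.DivMod
open import Data.Nat.Induction using (<-rec)
open import Data.Nat.Properties
open import Data.Nat.Tactic.RingSolver using (solve-∀)
open import Data.Product using (Σ; _×_; _,_; ∃; ∃₂; proj₁; proj₂)
open import Data.Sum using (_⊎_; inj₁; inj₂)
open import Data.Vec using (Vec; lookup; tabulate)
open import Data.Vec.Properties using (lookup∘tabulate; tabulate-cong)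
open import Function using (_∘_; id)
open import Relation.Binary.PropositionalEquality
open import Relation.Nullary using (¬_; Dec; yes; no; ¬?; contradiction)

-- The state graph

hand : ∀ {k} → State k → Fin k
hand = proj₁

height : ∀ {k} → State k → ℕ
height = proj₂

≤1⇒≤ : ∀ {a b} → a ≤ 1 → (a ≡ 1 → b ≡ 1) → a ≤ b
≤1⇒≤ z≤n       _   = z≤n
≤1⇒≤ (s≤s z≤n) 1⇒1 = ≤-reflexive (sym (1⇒1 refl))

entry≤1 : ∀ {k} (A : State k) i j → entry A i j ≤ 1
entry≤1 (i , m) i′ j with i Fin.≟ i′ | suc m ℕ.≟ j
... | yes _ | yes _ = ≤-refl
... | yes _ | no _  = z≤n
... | no _  | _     = z≤n

entry≡1⇒ : ∀ {k} {i i′ : Fin k} {m j} → entry (i , m) i′ j ≡ 1 → i ≡ i′ × suc m ≡ j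
entry≡1⇒ {i = i} {i′} {m} {j} e with i Fin.≟ i′ | suc m ℕ.≟ j
... | yes i≡i′ | yes m+1≡j = i≡i′ , m+1≡j
... | yes _    | no _      = contradiction e 0≢1+n
... | no _     | _         = contradiction e 0≢1+n

entry-self : ∀ {k} (i : Fin k) m → entry (i , m) i (suc m) ≡ 1
entry-self i m with i Fin.≟ i | suc m ℕ.≟ suc m
... | yes _  | yes _  = refl
... | yes _  | no m≢m = contradiction refl m≢m
... | no i≢i | _      = contradiction refl i≢i

landing⟶ : ∀ {k} {A : State k} → height A ≡ 0 → ∀ B → A ⟶ B
landing⟶ {A = i , 0} refl B i′ j 1≤j = ≤1⇒≤ (entry≤1 (i , 0) i′ (suc j)) λ e →
  contradiction (suc-injective (proj₂ (entry≡1⇒ e))) (<⇒≢ 1≤j)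

flying⟶ : ∀ {k} (i : Fin k) m → (i , suc m) ⟶ (i , m)
flying⟶ i m i′ j _ = ≤1⇒≤ (entry≤1 (i , suc m) i′ (suc j)) λ e → lands-at-j (entry≡1⇒ e)
  where
  lands-at-j : i ≡ i′ × suc (suc m) ≡ suc j → entry (i , m) i′ j ≡ 1
  lands-at-j (refl , refl) = entry-self i m

flying⟶-inv : ∀ {k} {i : Fin k} {m B} → (i , suc m) ⟶ B → B ≡ (i , m)
flying⟶-inv {i = i} {m} {B@(i′ , m′)} tr =
  same-state (entry≡1⇒ (≤-antisym (entry≤1 B i (suc m)) 1≤entry))
  where
  1≤entry : 1 ≤ entry B i (suc m)
  1≤entry = subst (_≤ entry B i (suc m)) (entry-self i (suc m)) (tr i (suc m) (s≤s z≤n))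
  same-state : i′ ≡ i × suc m′ ≡ suc m → B ≡ (i , m)
  same-state (refl , refl) = refl

walk-descends : ∀ {k} (u : ℕ → State k) → (∀ t → u t ⟶ u (suc t)) →
                ∀ {i m t} → u 0 ≡ (i , m) → t ≤ m → u t ≡ (i , m ∸ t)
walk-descends u step {t = zero}          u₀ _         = u₀
walk-descends u step {m = suc m} {suc t} u₀ (s≤s t≤m) =
  walk-descends (u ∘ suc) (step ∘ suc) (flying⟶-inv (subst (_⟶ u 1) u₀ (step 0))) t≤m

-- Throw sequences

-- A throw is recorded by the state right after it: (i , m) is a throw to hand i
-- that lands m + 1 beats later.
Throws : ℕ → Set
Throws k = List (State k)

period : ∀ {k} → Throws k → ℕ
period []             = 0
period ((_ , m) ∷ bs) = suc m + period bs

hands : ∀ {k} → Throws k → List (Fin k)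
hands = map hand

descend : ∀ {k} → State k → (ℕ → State k) → ℕ → State k
descend A           f zero    = A
descend (i , zero)  f (suc t) = f t
descend (i , suc m) f (suc t) = descend (i , m) f t

-- Beyond the period the value is junk.
trajectory : ∀ {K} → Throws (suc K) → ℕ → State (suc K)
trajectory []       _ = (Fin.zero , 0)
trajectory (A ∷ bs)   = descend A (trajectory bs)

data Phase (m : ℕ) : ℕ → Set where
  flight : ∀ {t} → t ≤ m → Phase m t
  after  : ∀ t → Phase m (suc m + t)

phase : ∀ m t → Phase m t
phase m t with t ℕ.≤? m
... | yes t≤m = flight t≤m
... | no  t≰m = subst (Phase m) (m+[n∸m]≡n (≰⇒> t≰m)) (after (t ∸ suc m))

descend-flight : ∀ {k} (i : Fin k) m f {t} → t ≤ m → descend (i , m) f t ≡ (i , m ∸ t)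
descend-flight i m       f {zero}  _         = refl
descend-flight i (suc m) f {suc t} (s≤s t≤m) = descend-flight i m f t≤m

descend-after : ∀ {k} (i : Fin k) m f t → descend (i , m) f (suc m + t) ≡ f t
descend-after i zero    f t = refl
descend-after i (suc m) f t = descend-after i m f t

descend-step : ∀ {k} (i : Fin k) m f R → (∀ t → suc t < R → f t ⟶ f (suc t)) →
               ∀ t → suc t < suc m + R → descend (i , m) f t ⟶ descend (i , m) f (suc t)
descend-step i zero    f R f-step zero    _         = landing⟶ refl (f 0)
descend-step i (suc m) f R f-step zero    _         = flying⟶ i m
descend-step i zero    f R f-step (suc t) (s≤s t<R) = f-step t t<R
descend-step i (suc m) f R f-step (suc t) (s≤s t<R) = descend-step i m f R f-step t t<R

InjectiveBelow : ∀ {A : Set} → ℕ → (ℕ → A) → Set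
InjectiveBelow R f = ∀ {t u} → t < R → u < R → f t ≡ f u → t ≡ u

module _ {K : ℕ} where

  trajectory-step : ∀ (bs : Throws (suc K)) t → suc t < period bs →
                    trajectory bs t ⟶ trajectory bs (suc t)
  trajectory-step ((i , m) ∷ bs) =
    descend-step i m (trajectory bs) (period bs) (trajectory-step bs)

  trajectory-lands : ∀ (bs : Throws (suc K)) t → suc t ≡ period bs → height (trajectory bs t) ≡ 0
  trajectory-lands ((i , m) ∷ bs) t t+1≡R with phase m t
  ... | flight t≤m = begin
    height (descend (i , m) (trajectory bs) t) ≡⟨ cong height (descend-flight i m _ t≤m) ⟩
    m ∸ t                                      ≡⟨ m≤n⇒m∸n≡0 m≤t ⟩
    0                                          ∎
    where
    open ≡-Reasoning
    m≤t : m ≤ t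
    m≤t = ≤-pred (m+n≤o⇒m≤o (suc m) (≤-reflexive (sym t+1≡R)))
  ... | after t′ = trans (cong height (descend-after i m _ t′))
    (trajectory-lands bs t′ (+-cancelˡ-≡ (suc m) _ _ (trans (+-suc (suc m) t′) t+1≡R)))

  trajectory-hand∈ : ∀ (bs : Throws (suc K)) {t} → t < period bs → hand (trajectory bs t) ∈ hands bs
  trajectory-hand∈ ((i , m) ∷ bs) {t} t<R with phase m t
  ... | flight t≤m = here (cong hand (descend-flight i m _ t≤m))
  ... | after t′   = there (subst (λ A → hand A ∈ hands bs) (sym (descend-after i m _ t′))
                                  (trajectory-hand∈ bs (+-cancelˡ-< (suc m) t′ _ t<R)))

  ∈hands⇒lands : ∀ (bs : Throws (suc K)) {i} → i ∈ hands bs →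
                 ∃ λ t → t < period bs × trajectory bs t ≡ (i , 0)
  ∈hands⇒lands ((i , m) ∷ bs) (here refl) =
    m , s≤s (m≤m+n m (period bs)) , trans (descend-flight i m _ ≤-refl) (cong (i ,_) (n∸n≡0 m))
  ∈hands⇒lands ((i , m) ∷ bs) (there j∈) with ∈hands⇒lands bs j∈
  ... | t , t<R , lands = suc m + t , +-monoʳ-< (suc m) t<R , trans (descend-after i m _ t) lands

  unique-hands⇒injective : ∀ (bs : Throws (suc K)) → Unique (hands bs) →
                           InjectiveBelow (period bs) (trajectory bs)
  unique-hands⇒injective ((i , m) ∷ bs) (i∉ ∷ unique) {t} {u} t<R u<R eq
    with phase m t | phase m u
  ... | flight t≤m | flight u≤m = ∸-cancelˡ-≡ t≤m u≤m (cong height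
    (trans (sym (descend-flight i m _ t≤m)) (trans eq (descend-flight i m _ u≤m))))
  ... | flight t≤m | after u′ = contradiction
    (cong hand (trans (sym (descend-flight i m _ t≤m)) (trans eq (descend-after i m _ u′))))
    (All.lookup i∉ (trajectory-hand∈ bs (+-cancelˡ-< (suc m) u′ _ u<R)))
  ... | after t′ | flight u≤m = contradiction
    (cong hand (trans (sym (descend-flight i m _ u≤m)) (trans (sym eq) (descend-after i m _ t′))))
    (All.lookup i∉ (trajectory-hand∈ bs (+-cancelˡ-< (suc m) t′ _ t<R)))
  ... | after t′ | after u′ = cong (suc m +_) (unique-hands⇒injective bs unique
    (+-cancelˡ-< (suc m) t′ _ t<R) (+-cancelˡ-< (suc m) u′ _ u<R)
    (trans (sym (descend-after i m _ t′)) (trans eq (descend-after i m _ u′))))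

  injective⇒unique-hands : ∀ (bs : Throws (suc K)) → InjectiveBelow (period bs) (trajectory bs) →
                           Unique (hands bs)
  injective⇒unique-hands []             _   = []
  injective⇒unique-hands ((i , m) ∷ bs) inj =
    All.tabulate i∉ ∷ injective⇒unique-hands bs tail-injective
    where
    shift< : ∀ {t} → t < period bs → suc m + t < suc m + period bs
    shift< = +-monoʳ-< (suc m)
    tail-injective : InjectiveBelow (period bs) (trajectory bs)
    tail-injective {t} {u} t<R u<R eq = +-cancelˡ-≡ (suc m) t u (inj (shift< t<R) (shift< u<R)
      (trans (descend-after i m _ t) (trans eq (sym (descend-after i m _ u)))))
    i∉ : ∀ {j} → j ∈ hands bs → i ≢ j
    i∉ j∈ refl with ∈hands⇒lands bs j∈
    ... | t , t<R , lands = m≢1+m+n m (inj (s≤s (m≤m+n m (period bs))) (shift< t<R)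
      (trans (descend-flight i m _ ≤-refl)
        (trans (cong (i ,_) (n∸n≡0 m)) (sym (trans (descend-after i m _ t) lands)))))

  trajectory-injective : ∀ {bs bs′ : Throws (suc K)} → period bs ≡ period bs′ →
                         (∀ {t} → t < period bs → trajectory bs t ≡ trajectory bs′ t) → bs ≡ bs′
  trajectory-injective {[]}           {[]}              _    _     = refl
  trajectory-injective {[]}           {_ ∷ _}           ()
  trajectory-injective {_ ∷ _}        {[]}              ()
  trajectory-injective {(i , m) ∷ bs} {(i′ , m′) ∷ bs′} R≡R′ agree with agree (s≤s z≤n)
  ... | refl = cong ((i , m) ∷_) (trajectory-injective (+-cancelˡ-≡ (suc m) _ _ R≡R′) λ t<R →
    trans (sym (descend-after i m _ _))
      (trans (agree (+-monoʳ-< (suc m) t<R)) (descend-after i m _ _)))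

  WalksAreTrajectories : ℕ → Set
  WalksAreTrajectories R = ∀ (u : ℕ → State (suc K)) → (∀ t → u t ⟶ u (suc t)) →
    (∀ t → suc t ≡ R → height (u t) ≡ 0) →
    ∃ λ bs → period bs ≡ R × (∀ {t} → t < R → trajectory bs t ≡ u t)

  walk⇒trajectory : ∀ R → WalksAreTrajectories R
  walk⇒trajectory = <-rec WalksAreTrajectories extract
    where
    extract : ∀ R → (∀ {R′} → R′ < R → WalksAreTrajectories R′) → WalksAreTrajectories R
    extract zero    _   u _    _     = [] , refl , λ ()
    extract (suc n) rec u step lands = (i , m) ∷ bs , period≡ , agree
      where
      i = hand (u 0)
      m = height (u 0)
      in-flight : ∀ {t} → t ≤ m → u t ≡ (i , m ∸ t)
      in-flight = walk-descends u step refl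
      m≤n : m ≤ n
      m≤n with m ℕ.≤? n
      ... | yes m≤n = m≤n
      ... | no  m≰n = contradiction
        (trans (sym (cong height (in-flight (<⇒≤ (≰⇒> m≰n))))) (lands n refl))
        (m>n⇒m∸n≢0 (≰⇒> m≰n))
      shift-step : ∀ t → u (suc m + t) ⟶ u (suc m + suc t)
      shift-step t = subst (u (suc m + t) ⟶_) (cong u (sym (+-suc (suc m) t))) (step (suc m + t))
      shift-lands : ∀ t → suc t ≡ n ∸ m → height (u (suc m + t)) ≡ 0
      shift-lands t t+1≡ = lands (suc m + t)
        (cong suc (trans (sym (+-suc m t)) (trans (cong (m +_) t+1≡) (m+[n∸m]≡n m≤n))))
      rest = rec (s≤s (m∸n≤m n m)) (λ t → u (suc m + t)) shift-step shift-lands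
      bs = proj₁ rest
      period≡ : suc m + period bs ≡ suc n
      period≡ = cong suc (trans (cong (m +_) (proj₁ (proj₂ rest))) (m+[n∸m]≡n m≤n))
      agree : ∀ {t} → t < suc n → descend (i , m) (trajectory bs) t ≡ u t
      agree {t} t<R with phase m t
      ... | flight t≤m = trans (descend-flight i m _ t≤m) (sym (in-flight t≤m))
      ... | after t′   = trans (descend-after i m _ t′) (proj₂ (proj₂ rest)
        (subst (_< n ∸ m) (m+n∸m≡n m t′) (∸-monoˡ-< (≤-pred t<R) (m≤m+n m t′))))

[m%n+o]%n≡[m+o]%n : ∀ m o n .{{_ : NonZero n}} → (m % n + o) % n ≡ (m + o) % n
[m%n+o]%n≡[m+o]%n m o n = begin
  (m % n + o) % n         ≡⟨ %-distribˡ-+ (m % n) o n ⟩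
  (m % n % n + o % n) % n ≡⟨ cong (λ a → (a + o % n) % n) (m%n%n≡m%n m n) ⟩
  (m % n + o % n) % n     ≡⟨ %-distribˡ-+ m o n ⟨
  (m + o) % n             ∎
  where open ≡-Reasoning

[r+x]%n≡[r+y]%n⇒x≡y : ∀ r {x y} n .{{_ : NonZero n}} → x < n → y < n →
                      (r + x) % n ≡ (r + y) % n → x ≡ y
[r+x]%n≡[r+y]%n⇒x≡y r {x} {y} n x<n y<n eq =
  trans (sym (unshift x<n)) (trans (cong (λ a → (a + (n ∸ r % n)) % n) eq) (unshift y<n))
  where
  open ≡-Reasoning
  rearrange : ∀ a b c d → a + b + c + d ≡ c + (a + d) + b
  rearrange = solve-∀
  unshift : ∀ {x} → x < n → ((r + x) % n + (n ∸ r % n)) % n ≡ x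
  unshift {x} x<n = begin
    ((r + x) % n + (n ∸ r % n)) % n             ≡⟨ [m%n+o]%n≡[m+o]%n (r + x) (n ∸ r % n) n ⟩
    (r + x + (n ∸ r % n)) % n                   ≡⟨ cong (λ a → (a + x + (n ∸ r % n)) % n)
                                                         (m≡m%n+[m/n]*n r n) ⟩
    (r % n + r / n * n + x + (n ∸ r % n)) % n   ≡⟨ cong (_% n) (rearrange (r % n) (r / n * n) x (n ∸ r % n)) ⟩
    (x + (r % n + (n ∸ r % n)) + r / n * n) % n ≡⟨ [m+kn]%n≡m%n (x + (r % n + (n ∸ r % n))) (r / n) n ⟩
    (x + (r % n + (n ∸ r % n))) % n             ≡⟨ cong (λ a → (x + a) % n) (m+[n∸m]≡n (m%n≤n r n)) ⟩
    (x + n) % n                                 ≡⟨ [m+n]%n≡m%n x n ⟩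
    x % n                                       ≡⟨ m<n⇒m%n≡m x<n ⟩
    x                                           ∎

module _ {N : ℕ} .{{_ : NonZero N}} where

  toℕ-mod : ∀ x → toℕ (x mod N) ≡ x % N
  toℕ-mod x = Fin.toℕ-fromℕ< _

  mod-cong : ∀ {x y} → x % N ≡ y % N → x mod N ≡ y mod N
  mod-cong {x} {y} eq = Fin.toℕ-injective (trans (toℕ-mod x) (trans eq (sym (toℕ-mod y))))

  next-mod : ∀ x → next (x mod N) ≡ suc x mod N
  next-mod x = Fin.toℕ-injective (begin
    toℕ (next (x mod N))    ≡⟨ toℕ-mod (suc (toℕ (x mod N))) ⟩
    suc (toℕ (x mod N)) % N ≡⟨ cong (λ a → suc a % N) (toℕ-mod x) ⟩
    suc (x % N) % N         ≡⟨ cong (_% N) (+-comm 1 (x % N)) ⟩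
    (x % N + 1) % N         ≡⟨ [m%n+o]%n≡[m+o]%n x 1 N ⟩
    (x + 1) % N             ≡⟨ cong (_% N) (+-comm x 1) ⟩
    suc x % N               ≡⟨ toℕ-mod (suc x) ⟨
    toℕ (suc x mod N)       ∎)
    where open ≡-Reasoning

module _ {A : Set} {N : ℕ} .{{_ : NonZero N}} where

  periodic : Vec A N → ℕ → A
  periodic s x = lookup s (x mod N)

  periodic-toℕ : ∀ (s : Vec A N) t → periodic s (toℕ t) ≡ lookup s t
  periodic-toℕ s t =
    cong (lookup s) (Fin.toℕ-injective (trans (toℕ-mod (toℕ t)) (m<n⇒m%n≡m (Fin.toℕ<n t))))

  periodic-+N : ∀ (s : Vec A N) x → periodic s (x + N) ≡ periodic s x
  periodic-+N s x = cong (lookup s) (mod-cong ([m+n]%n≡m%n x N))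

  lookup-rot : ∀ r (s : Vec A N) t → lookup (rot r s) t ≡ periodic s (toℕ r + toℕ t)
  lookup-rot r s = lookup∘tabulate _

module _ {k N : ℕ} .{{_ : NonZero N}} (s : Vec (State k) N) (cyc : IsCycle s) where

  periodic-step : ∀ x → periodic s x ⟶ periodic s (suc x)
  periodic-step x = subst (periodic s x ⟶_) (cong (lookup s) (next-mod x)) (proj₂ cyc (x mod N))

  periodic-injective : ∀ {x y} → periodic s x ≡ periodic s y → x % N ≡ y % N
  periodic-injective {x} {y} eq = trans (sym (toℕ-mod x)) (trans (cong toℕ (proj₁ cyc _ _ eq)) (toℕ-mod y))

-- Canonical representatives

module _ {k n : ℕ} (s : Vec (State k) (suc n)) where

  CanonicalStart : Fin (suc n) → Set
  CanonicalStart r = (∀ t → hand (lookup s r) Fin.≤ hand (lookup s t))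
                   × (∀ t → hand (lookup s t) ≡ hand (lookup s r) →
                            height (lookup s t) ≤ height (lookup s r))

  canonicalStart : ∃ CanonicalStart
  canonicalStart = r , (λ t → subst (Fin._≤ hand (lookup s t)) (sym r-hand) (i-min t))
                     , (λ t hand≡ → r-max t (trans hand≡ r-hand))
    where
    positions : List (Fin (suc n))
    positions = allFin (suc n)
    hand-index : Fin (suc n) → ℕ
    hand-index = toℕ ∘ hand ∘ lookup s
    p : Fin (suc n)
    p = argmin hand-index Fin.zero positions
    i : Fin k
    i = hand (lookup s p)
    i-min : ∀ t → i Fin.≤ hand (lookup s t)
    i-min t = All.lookup (f[argmin]≤f[xs] {f = hand-index} Fin.zero positions) (∈-allFin t)
    Carries-i : Fin (suc n) → Set
    Carries-i t = hand (lookup s t) ≡ i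
    carries-i? : ∀ t → Dec (Carries-i t)
    carries-i? t = hand (lookup s t) Fin.≟ i
    r : Fin (suc n)
    r = argmax (height ∘ lookup s) p (filter carries-i? positions)
    r-hand : Carries-i r
    r-hand = argmax-all (height ∘ lookup s) {P = Carries-i} refl (All.all-filter carries-i? positions)
    r-max : ∀ t → Carries-i t → height (lookup s t) ≤ height (lookup s r)
    r-max t carries = All.lookup (f[xs]≤f[argmax] {f = height ∘ lookup s} p (filter carries-i? positions))
                                 (∈-filter⁺ carries-i? (∈-allFin t) carries)

  -- Were the state before r in flight, it would carry r's hand one beat higher.
  canonicalStart-lands : IsCycle s → ∀ {r} → CanonicalStart r → height (periodic s (toℕ r + n)) ≡ 0
  canonicalStart-lands cyc {r} (_ , highest) = landing _ refl
    where
    returns : periodic s (suc (toℕ r + n)) ≡ lookup s r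
    returns = trans (cong (periodic s) (sym (+-suc (toℕ r) n)))
                    (trans (periodic-+N s (toℕ r)) (periodic-toℕ s r))
    landing : ∀ A → periodic s (toℕ r + n) ≡ A → height A ≡ 0
    landing (j , zero)  _  = refl
    landing (j , suc h) eq = contradiction
      (subst₂ (λ A B → height A ≤ height B) eq (sym r≡)
              (highest ((toℕ r + n) mod suc n) (trans (cong hand eq) (cong hand r≡))))
      (n≮n h)
      where
      r≡ : (j , h) ≡ lookup s r
      r≡ = trans (sym (flying⟶-inv
             (subst (_⟶ periodic s (suc (toℕ r + n))) eq (periodic-step s cyc (toℕ r + n)))))
           returns

Canonical : ∀ {k} → Throws k → Set
Canonical []             = ⊥
Canonical ((i , _) ∷ bs) = All (i Fin.<_) (hands bs) × Unique (hands bs)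

canonical⇒unique-hands : ∀ {k} (bs : Throws k) → Canonical bs → Unique (hands bs)
canonical⇒unique-hands ((i , _) ∷ bs) (i< , unique) = All.map Fin.<⇒≢ i< ∷ unique

module _ {K : ℕ} where

  canonical-min : ∀ {i m bs} → Canonical {suc K} ((i , m) ∷ bs) →
                  ∀ {t} → t < period ((i , m) ∷ bs) → i Fin.≤ hand (trajectory ((i , m) ∷ bs) t)
  canonical-min {i} {m} {bs} (i< , _) {t} t<R with phase m t
  ... | flight t≤m = Fin.≤-reflexive (sym (cong hand (descend-flight i m _ t≤m)))
  ... | after t′   = subst (λ A → i Fin.≤ hand A) (sym (descend-after i m _ t′))
    (<⇒≤ (All.lookup i< (trajectory-hand∈ bs (+-cancelˡ-< (suc m) t′ _ t<R))))

  canonical-first-block : ∀ {i m bs} → Canonical {suc K} ((i , m) ∷ bs) →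
    ∀ {t} → t < period ((i , m) ∷ bs) → hand (trajectory ((i , m) ∷ bs) t) ≡ i → t ≤ m
  canonical-first-block {i} {m} {bs} (i< , _) {t} t<R hand≡i with phase m t
  ... | flight t≤m = t≤m
  ... | after t′   = contradiction (trans (sym hand≡i) (cong hand (descend-after i m _ t′)))
    (Fin.<⇒≢ (All.lookup i< (trajectory-hand∈ bs (+-cancelˡ-< (suc m) t′ _ t<R))))

  first-hand-min⇒canonical : ∀ (bs : Throws (suc K)) {n} → period bs ≡ suc n → Unique (hands bs) →
    (∀ {t} → t < period bs → hand (trajectory bs 0) Fin.≤ hand (trajectory bs t)) → Canonical bs
  first-hand-min⇒canonical ((i , m) ∷ bs) _ (i∉ ∷ unique) i-min =
    All.zipWith (λ (i≢j , i≤j) → Fin.≤∧≢⇒< i≤j i≢j) (i∉ , All.tabulate i≤) , unique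
    where
    i≤ : ∀ {j} → j ∈ hands bs → i Fin.≤ j
    i≤ j∈ with ∈hands⇒lands ((i , m) ∷ bs) (there j∈)
    ... | t , t<R , lands = subst (λ A → i Fin.≤ hand A) lands (i-min t<R)

  cycleOf : ∀ {N} → Throws (suc K) → Vec (State (suc K)) N
  cycleOf bs = tabulate (trajectory bs ∘ toℕ)

  lookup-cycleOf : ∀ {N} (bs : Throws (suc K)) (t : Fin N) → lookup (cycleOf bs) t ≡ trajectory bs (toℕ t)
  lookup-cycleOf bs = lookup∘tabulate _

  cycleOf-isCycle : ∀ {n} (bs : Throws (suc K)) → period bs ≡ suc n → Unique (hands bs) →
                    IsCycle (cycleOf {suc n} bs)
  cycleOf-isCycle {n} bs R≡N unique = injective , transition
    where
    <R : ∀ (t : Fin (suc n)) → toℕ t < period bs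
    <R t = subst (toℕ t <_) (sym R≡N) (Fin.toℕ<n t)
    injective : ∀ t u → lookup (cycleOf bs) t ≡ lookup (cycleOf bs) u → t ≡ u
    injective t u eq = Fin.toℕ-injective (unique-hands⇒injective bs unique (<R t) (<R u)
      (trans (sym (lookup-cycleOf bs t)) (trans eq (lookup-cycleOf bs u))))
    transition : ∀ t → lookup (cycleOf bs) t ⟶ lookup (cycleOf bs) (next t)
    transition t rewrite lookup-cycleOf bs t | lookup-cycleOf bs (next t) with suc (toℕ t) ℕ.<? suc n
    ... | yes t+1<N = subst (λ x → trajectory bs (toℕ t) ⟶ trajectory bs x)
      (sym (trans (toℕ-mod (suc (toℕ t))) (m<n⇒m%n≡m t+1<N)))
      (trajectory-step bs (toℕ t) (subst (suc (toℕ t) <_) (sym R≡N) t+1<N))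
    ... | no  t+1≮N = landing⟶ (trajectory-lands bs (toℕ t)
      (trans (≤-antisym (Fin.toℕ<n t) (≮⇒≥ t+1≮N)) (sym R≡N))) _

  cycle⇒canonical : ∀ {n} (s : Vec (State (suc K)) (suc n)) → IsCycle s →
                    ∃ λ b → Canonical b × period b ≡ suc n × RotEquiv s (cycleOf b)
  cycle⇒canonical {n} s cyc = b , canonical , R≡N , r , tabulate-cong (λ t → agree (Fin.toℕ<n t))
    where
    start = canonicalStart s
    r = proj₁ start
    u : ℕ → State (suc K)
    u x = periodic s (toℕ r + x)
    u₀ : u 0 ≡ lookup s r
    u₀ = trans (cong (periodic s) (+-identityʳ (toℕ r))) (periodic-toℕ s r)
    u-step : ∀ x → u x ⟶ u (suc x)
    u-step x = subst (u x ⟶_) (cong (periodic s) (sym (+-suc (toℕ r) x))) (periodic-step s cyc (toℕ r + x))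
    u-lands : ∀ t → suc t ≡ suc n → height (u t) ≡ 0
    u-lands t refl = canonicalStart-lands s cyc (proj₂ start)
    walk = walk⇒trajectory (suc n) u u-step u-lands
    b = proj₁ walk
    R≡N : period b ≡ suc n
    R≡N = proj₁ (proj₂ walk)
    agree : ∀ {t} → t < suc n → trajectory b t ≡ u t
    agree = proj₂ (proj₂ walk)
    <N : ∀ {t} → t < period b → t < suc n
    <N {t} = subst (t <_) R≡N
    unique : Unique (hands b)
    unique = injective⇒unique-hands b λ {t} {t′} t<R t′<R eq →
      [r+x]%n≡[r+y]%n⇒x≡y (toℕ r) (suc n) (<N t<R) (<N t′<R)
        (periodic-injective s cyc {toℕ r + t} {toℕ r + t′}
          (trans (sym (agree (<N t<R))) (trans eq (agree (<N t′<R)))))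
    canonical : Canonical b
    canonical = first-hand-min⇒canonical b R≡N unique λ {t} t<R →
      subst₂ Fin._≤_ (cong hand (sym (trans (agree (s≤s z≤n)) u₀))) (cong hand (sym (agree (<N t<R))))
             (proj₁ (proj₂ start) ((toℕ r + t) mod suc n))

  rotation⇒shift : ∀ {n} (b b′ : Throws (suc K)) r → cycleOf {suc n} b′ ≡ rot r (cycleOf b) →
                   ∀ {x} → x < suc n → trajectory b′ x ≡ trajectory b ((toℕ r + x) % suc n)
  rotation⇒shift {n} b b′ r eq {x} x<N = begin
    trajectory b′ x                                ≡⟨ cong (trajectory b′) (Fin.toℕ-fromℕ< x<N) ⟨
    trajectory b′ (toℕ t)                          ≡⟨ lookup-cycleOf b′ t ⟨
    lookup (cycleOf b′) t                          ≡⟨ cong (λ s → lookup s t) eq ⟩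
    lookup (rot r (cycleOf b)) t                   ≡⟨ lookup-rot r (cycleOf b) t ⟩
    periodic (cycleOf b) (toℕ r + toℕ t)           ≡⟨ lookup-cycleOf b _ ⟩
    trajectory b (toℕ ((toℕ r + toℕ t) mod suc n)) ≡⟨ cong (trajectory b) (toℕ-mod (toℕ r + toℕ t)) ⟩
    trajectory b ((toℕ r + toℕ t) % suc n)         ≡⟨ cong (λ y → trajectory b ((toℕ r + y) % suc n))
                                                            (Fin.toℕ-fromℕ< x<N) ⟩
    trajectory b ((toℕ r + x) % suc n)             ∎
    where
    open ≡-Reasoning
    t = Fin.fromℕ< x<N

  -- Both sequences start with the smallest hand, so a shift ρ > 0 falls inside
  -- the first flight of b; but then the state before it is still in flight,
  -- while b′ lands at its last beat.
  canonical-shift≡0 : ∀ {n} {b b′ : Throws (suc K)} → Canonical b → Canonical b′ →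
    period b ≡ suc n → period b′ ≡ suc n → ∀ ρ → ρ < suc n →
    (∀ {x} → x < suc n → trajectory b′ x ≡ trajectory b ((ρ + x) % suc n)) → ρ ≡ 0
  canonical-shift≡0 _ _ _ _ zero _ _ = refl
  canonical-shift≡0 {n} {b@((i , m) ∷ bs)} {b′@((i′ , m′) ∷ bs′)} canon canon′ R≡N R′≡N
                    (suc ρ) ρ<N shift =
    contradiction (trans (sym (cong height last≡)) (trajectory-lands b′ n (sym R′≡N)))
                  (m>n⇒m∸n≢0 ρ<m)
    where
    <R : ∀ {x} → x < suc n → x < period b
    <R {x} = subst (x <_) (sym R≡N)
    <R′ : ∀ {x} → x < suc n → x < period b′
    <R′ {x} = subst (x <_) (sym R′≡N)
    ρ≤n : ρ ≤ n
    ρ≤n = ≤-pred (<⇒≤ ρ<N)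
    first≡ : (i′ , m′) ≡ trajectory b (suc ρ)
    first≡ = trans (shift (s≤s z≤n))
      (cong (trajectory b) (trans (cong (_% suc n) (+-identityʳ (suc ρ))) (m<n⇒m%n≡m ρ<N)))
    back≡ : trajectory b′ (n ∸ ρ) ≡ (i , m)
    back≡ = trans (shift (s≤s (m∸n≤m n ρ)))
      (cong (trajectory b) (trans (cong (λ y → suc y % suc n) (m+[n∸m]≡n ρ≤n)) (n%n≡0 (suc n))))
    i≡i′ : i ≡ i′
    i≡i′ = Fin.≤-antisym
      (subst (λ A → i Fin.≤ hand A) (sym first≡) (canonical-min canon (<R ρ<N)))
      (subst (λ A → i′ Fin.≤ hand A) back≡ (canonical-min canon′ (<R′ (s≤s (m∸n≤m n ρ)))))
    ρ<m : suc ρ ≤ m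
    ρ<m = canonical-first-block canon (<R ρ<N) (sym (trans i≡i′ (cong hand first≡)))
    last≡ : trajectory b′ n ≡ (i , m ∸ ρ)
    last≡ = trans (shift ≤-refl) (trans
      (cong (trajectory b) (trans (cong (_% suc n) (sym (+-suc ρ n)))
        (trans ([m+n]%n≡m%n ρ (suc n)) (m<n⇒m%n≡m (<⇒≤ ρ<N)))))
      (descend-flight i m _ (<⇒≤ ρ<m)))

  canonical-rotation⇒≡ : ∀ {n} {b b′ : Throws (suc K)} → Canonical b → Canonical b′ →
    period b ≡ suc n → period b′ ≡ suc n → RotEquiv (cycleOf {suc n} b) (cycleOf b′) → b′ ≡ b
  canonical-rotation⇒≡ {n} {b} {b′} canon canon′ R≡N R′≡N (r , eq) =
    trajectory-injective (trans R′≡N (sym R≡N)) λ {x} x<R′ →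
      let x<N = subst (x <_) R′≡N x<R′ in
      trans (shift x<N) (cong (trajectory b) (trans (cong (λ ρ → (ρ + x) % suc n) r≡0) (m<n⇒m%n≡m x<N)))
    where
    shift = rotation⇒shift b b′ r eq
    r≡0 : toℕ r ≡ 0
    r≡0 = canonical-shift≡0 canon canon′ R≡N R′≡N (toℕ r) (Fin.toℕ<n r) shift

-- Enumeration

length-concatMap-const : ∀ {A B : Set} (f : A → List B) {c} xs →
  (∀ {x} → x ∈ xs → length (f x) ≡ c) → length (concatMap f xs) ≡ length xs * c
length-concatMap-const f []       _       = refl
length-concatMap-const f (x ∷ xs) length≡ = trans (length-++ (f x))
  (cong₂ _+_ (length≡ (here refl)) (length-concatMap-const f xs (length≡ ∘ there)))

countUpTo : ℕ → ℕ → ℕ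
countUpTo j zero    = 1
countUpTo j (suc L) = countUpTo j L + j * countUpTo (ℕ.pred j) L

countCanonical : ℕ → ℕ → ℕ
countCanonical zero    n = 0
countCanonical (suc j) n = countUpTo j n + countCanonical j n

module _ {k : ℕ} where

  _∖_ : List (Fin k) → Fin k → List (Fin k)
  A ∖ a = filter (λ j → ¬? (j Fin.≟ a)) A

  ∈-∖⁺ : ∀ {A a j} → j ∈ A → j ≢ a → j ∈ A ∖ a
  ∈-∖⁺ = ∈-filter⁺ (λ j → ¬? (j Fin.≟ _))

  ∈-∖⁻ : ∀ A {a j} → j ∈ A ∖ a → j ∈ A × j ≢ a
  ∈-∖⁻ A = ∈-filter⁻ (λ j → ¬? (j Fin.≟ _)) {xs = A}

  ∖-unique : ∀ {A} a → Unique A → Unique (A ∖ a)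
  ∖-unique a = Unique.filter⁺ (λ j → ¬? (j Fin.≟ a))

  length-∖ : ∀ {A a} → Unique A → a ∈ A → suc (length (A ∖ a)) ≡ length A
  length-∖ {x ∷ A} {a} (x∉ ∷ unique) a∈ with x Fin.≟ a | a∈
  ... | yes refl | _         =
    cong (suc ∘ length) (filter-all (λ j → ¬? (j Fin.≟ a)) (All.map (λ a≢j j≡a → a≢j (sym j≡a)) x∉))
  ... | no  x≢a  | here a≡x  = contradiction (sym a≡x) x≢a
  ... | no  _    | there a∈A = cong suc (length-∖ unique a∈A)

  close : Fin k → ℕ → Throws k → Throws k
  close a L bs = (a , L ∸ period bs) ∷ bs

  period-close : ∀ a {L} bs → period bs ≤ L → period (close a L bs) ≡ suc L
  period-close a bs R≤L = cong suc (m∸n+n≡m R≤L)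

  period≡suc⇒close : ∀ {a m bs L} → period ((a , m) ∷ bs) ≡ suc L →
                     (a , m) ∷ bs ≡ close a L bs × period bs ≤ L
  period≡suc⇒close {a} {m} {bs} R≡ =
    cong (λ h → (a , h) ∷ bs)
         (sym (trans (cong (_∸ period bs) (suc-injective (sym R≡))) (m+n∸n≡m m (period bs)))) ,
    subst (period bs ≤_) (suc-injective R≡) (m≤n+m (period bs) m)

  Within : List (Fin k) → ℕ → Throws k → Set
  Within A L bs = Unique (hands bs) × hands bs ⊆ A × period bs ≤ L

  close-within : ∀ {A a L bs} → a ∈ A → Within (A ∖ a) L bs → Within A (suc L) (close a L bs)
  close-within {A} {a} {bs = bs} a∈ (unique , ⊆A∖a , R≤L) =
    All.tabulate (λ j∈ a≡j → proj₂ (∈-∖⁻ A (⊆A∖a j∈)) (sym a≡j)) ∷ unique ,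
    (λ { (here refl) → a∈ ; (there j∈) → proj₁ (∈-∖⁻ A (⊆A∖a j∈)) }) ,
    ≤-reflexive (period-close a bs R≤L)

  mutual
    throwsUpTo : List (Fin k) → ℕ → List (Throws k)
    throwsUpTo A zero    = [] ∷ []
    throwsUpTo A (suc L) = throwsUpTo A L ++ throwsExactly A L

    -- period exactly suc L, not L
    throwsExactly : List (Fin k) → ℕ → List (Throws k)
    throwsExactly A L = concatMap (λ a → map (close a L) (throwsUpTo (A ∖ a) L)) A

  ∈-throwsExactly⁻ : ∀ {A} L {bs} → bs ∈ throwsExactly A L →
                     ∃₂ λ a bs′ → a ∈ A × bs′ ∈ throwsUpTo (A ∖ a) L × bs ≡ close a L bs′
  ∈-throwsExactly⁻ {A} L bs∈
    with find (∈-concatMap⁻ (λ a → map (close a L) (throwsUpTo (A ∖ a) L)) {xs = A} bs∈)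
  ... | a , a∈ , bs∈a with ∈-map⁻ (close a L) bs∈a
  ... | bs′ , bs′∈ , refl = a , bs′ , a∈ , bs′∈ , refl

  throwsUpTo-sound : ∀ {A} L {bs} → Unique A → bs ∈ throwsUpTo A L → Within A L bs
  throwsUpTo-sound zero    _      (here refl) = [] , (λ ()) , z≤n
  throwsUpTo-sound {A} (suc L) unique bs∈ with ∈-++⁻ (throwsUpTo A L) bs∈
  ... | inj₁ bs∈L =
    let (unique′ , ⊆A , R≤L) = throwsUpTo-sound L unique bs∈L in unique′ , ⊆A , m≤n⇒m≤1+n R≤L
  ... | inj₂ bs∈E with ∈-throwsExactly⁻ L bs∈E
  ... | a , bs′ , a∈ , bs′∈ , bs≡ =
    subst (Within A (suc L)) (sym bs≡) (close-within a∈ (throwsUpTo-sound L (∖-unique a unique) bs′∈))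

  throwsUpTo-complete : ∀ {A} L {bs} → Within A L bs → bs ∈ throwsUpTo A L
  throwsUpTo-complete zero    {[]} _ = here refl
  throwsUpTo-complete {A} (suc L) {bs} (unique , ⊆A , R≤) with m≤n⇒m<n∨m≡n R≤
  ... | inj₁ R≤L = ∈-++⁺ˡ (throwsUpTo-complete L (unique , ⊆A , ≤-pred R≤L))
  throwsUpTo-complete {A} (suc L) {(a , m) ∷ bs} (a∉ ∷ unique , ⊆A , _) | inj₂ R≡
    with period≡suc⇒close {a} {m} {bs} R≡
  ... | bs≡ , R≤L = ∈-++⁺ʳ (throwsUpTo A L) (∈-concatMap⁺ closures (lose (⊆A (here refl))
    (subst (_∈ closures a) (sym bs≡) (∈-map⁺ (close a L) (throwsUpTo-complete L (unique , ⊆A∖a , R≤L))))))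
    where
    closures : Fin k → List (Throws k)
    closures a = map (close a L) (throwsUpTo (A ∖ a) L)
    ⊆A∖a : hands bs ⊆ A ∖ a
    ⊆A∖a j∈ = ∈-∖⁺ (⊆A (there j∈)) (λ j≡a → All.lookup a∉ j∈ (sym j≡a))

  throwsExactly-period : ∀ {A} L {bs} → Unique A → bs ∈ throwsExactly A L → period bs ≡ suc L
  throwsExactly-period {A} L unique bs∈ with ∈-throwsExactly⁻ {A} L bs∈
  ... | a , bs′ , _ , bs′∈ , refl =
    period-close a bs′ (proj₂ (proj₂ (throwsUpTo-sound L (∖-unique a unique) bs′∈)))

  throwsUpTo-unique : ∀ {A} L → Unique A → Unique (throwsUpTo A L)
  throwsUpTo-unique zero        _      = [] ∷ []
  throwsUpTo-unique {A} (suc L) unique =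
    Unique.++⁺ (throwsUpTo-unique L unique) exactly-unique upTo∩exactly≡∅
    where
    closures : Fin k → List (Throws k)
    closures a = map (close a L) (throwsUpTo (A ∖ a) L)
    closures-disjoint : ∀ {a a′} → a ≢ a′ → Disjoint (closures a) (closures a′)
    closures-disjoint a≢a′ (x∈ , x∈′) with ∈-map⁻ _ x∈ | ∈-map⁻ _ x∈′
    ... | _ , _ , refl | _ , _ , x≡ = a≢a′ (cong hand (∷-injectiveˡ x≡))
    exactly-unique : Unique (throwsExactly A L)
    exactly-unique = Unique.concat⁺
      (All.map⁺ (All.tabulate λ {a} _ → Unique.map⁺ ∷-injectiveʳ (throwsUpTo-unique L (∖-unique a unique))))
      (AllPairs.map⁺ (AllPairs.map closures-disjoint unique))
    upTo∩exactly≡∅ : Disjoint (throwsUpTo A L) (throwsExactly A L)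
    upTo∩exactly≡∅ (x∈L , x∈E) = n≮n L (subst (_≤ L) (throwsExactly-period L unique x∈E)
      (proj₂ (proj₂ (throwsUpTo-sound L unique x∈L))))

  length-throwsUpTo : ∀ {A} L → Unique A → length (throwsUpTo A L) ≡ countUpTo (length A) L
  length-throwsUpTo zero        _      = refl
  length-throwsUpTo {A} (suc L) unique = trans (length-++ (throwsUpTo A L))
    (cong₂ _+_ (length-throwsUpTo L unique) (length-concatMap-const _ A length-closures))
    where
    length-closures : ∀ {a} → a ∈ A →
                      length (map (close a L) (throwsUpTo (A ∖ a) L)) ≡ countUpTo (ℕ.pred (length A)) L
    length-closures {a} a∈ = begin
      length (map (close a L) (throwsUpTo (A ∖ a) L)) ≡⟨ length-map (close a L) (throwsUpTo (A ∖ a) L) ⟩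
      length (throwsUpTo (A ∖ a) L)                   ≡⟨ length-throwsUpTo {A ∖ a} L (∖-unique a unique) ⟩
      countUpTo (length (A ∖ a)) L                    ≡⟨ cong (λ j → countUpTo (ℕ.pred j) L)
                                                              (length-∖ unique a∈) ⟩
      countUpTo (ℕ.pred (length A)) L                 ∎
      where open ≡-Reasoning

  Sorted : List (Fin k) → Set
  Sorted = AllPairs.AllPairs Fin._<_

  sorted⇒unique : ∀ {A} → Sorted A → Unique A
  sorted⇒unique = AllPairs.map Fin.<⇒≢

  canonicalThrows : List (Fin k) → ℕ → List (Throws k)
  canonicalThrows []      n = []
  canonicalThrows (a ∷ A) n = map (close a n) (throwsUpTo A n) ++ canonicalThrows A n

  canonicalThrows-sound : ∀ A n {bs} → Sorted A → bs ∈ canonicalThrows A n →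
                          Canonical bs × hands bs ⊆ A × period bs ≡ suc n
  canonicalThrows-sound (a ∷ A) n (a<A ∷ sorted) bs∈ with ∈-++⁻ (map (close a n) (throwsUpTo A n)) bs∈
  ... | inj₂ bs∈A =
    let (canonical , ⊆A , R≡) = canonicalThrows-sound A n sorted bs∈A in canonical , there ∘ ⊆A , R≡
  ... | inj₁ bs∈a with ∈-map⁻ (close a n) bs∈a
  ... | bs′ , bs′∈ , refl with throwsUpTo-sound {A} n (sorted⇒unique sorted) bs′∈
  ... | unique , ⊆A , R≤n =
    (All.tabulate (All.lookup a<A ∘ ⊆A) , unique) ,
    (λ { (here refl) → here refl ; (there j∈) → there (⊆A j∈) }) ,
    period-close a bs′ R≤n

  private
    ∈-tail : ∀ {a : Fin k} {A j} → j ∈ a ∷ A → a Fin.< j → j ∈ A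
    ∈-tail (here refl) a<a = contradiction refl (Fin.<⇒≢ a<a)
    ∈-tail (there j∈)  _   = j∈

  canonicalThrows-complete : ∀ A n {bs} → Sorted A → Canonical bs → hands bs ⊆ A → period bs ≡ suc n →
                             bs ∈ canonicalThrows A n
  canonicalThrows-complete _  n {[]} _ () _ _
  canonicalThrows-complete [] n {(i , m) ∷ bs} _ _ ⊆[] _ with ⊆[] (here refl)
  ... | ()
  canonicalThrows-complete (a ∷ A) n {(i , m) ∷ bs} (a<A ∷ sorted) (i<bs , unique) ⊆aA R≡
    with ⊆aA (here refl) | period≡suc⇒close {i} {m} {bs} R≡
  ... | here refl | bs≡ , R≤n = ∈-++⁺ˡ (subst (_∈ map (close a n) (throwsUpTo A n)) (sym bs≡)
    (∈-map⁺ (close a n) (throwsUpTo-complete n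
      (unique , (λ j∈ → ∈-tail (⊆aA (there j∈)) (All.lookup i<bs j∈)) , R≤n))))
  ... | there i∈A | _ = ∈-++⁺ʳ (map (close a n) (throwsUpTo A n))
    (canonicalThrows-complete A n sorted (i<bs , unique) ⊆A R≡)
    where
    ⊆A : hands ((i , m) ∷ bs) ⊆ A
    ⊆A (here refl) = i∈A
    ⊆A (there j∈)  = ∈-tail (⊆aA (there j∈)) (Fin.<-trans (All.lookup a<A i∈A) (All.lookup i<bs j∈))

  canonicalThrows-unique : ∀ A n → Sorted A → Unique (canonicalThrows A n)
  canonicalThrows-unique []      n _              = []
  canonicalThrows-unique (a ∷ A) n (a<A ∷ sorted) =
    Unique.++⁺ (Unique.map⁺ ∷-injectiveʳ (throwsUpTo-unique n (sorted⇒unique sorted)))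
               (canonicalThrows-unique A n sorted) head-a∩rest≡∅
    where
    head-a∩rest≡∅ : Disjoint (map (close a n) (throwsUpTo A n)) (canonicalThrows A n)
    head-a∩rest≡∅ (x∈a , x∈A) with ∈-map⁻ (close a n) x∈a
    ... | _ , _ , refl = contradiction refl
      (Fin.<⇒≢ (All.lookup a<A (proj₁ (proj₂ (canonicalThrows-sound A n sorted x∈A)) (here refl))))

  length-canonicalThrows : ∀ A n → Sorted A → length (canonicalThrows A n) ≡ countCanonical (length A) n
  length-canonicalThrows []      n _            = refl
  length-canonicalThrows (a ∷ A) n (_ ∷ sorted) = trans (length-++ (map (close a n) (throwsUpTo A n)))
    (cong₂ _+_ (trans (length-map (close a n) (throwsUpTo A n)) (length-throwsUpTo n (sorted⇒unique sorted)))
               (length-canonicalThrows A n sorted))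

allFin-sorted : ∀ k → Sorted (allFin k)
allFin-sorted k = AllPairs.tabulate⁺-< id

AllPairs-refine : ∀ {A : Set} {P : A → Set} {R S : A → A → Set} →
  (∀ {x y} → P x → P y → R x y → S x y) →
  ∀ {xs} → All P xs → AllPairs.AllPairs R xs → AllPairs.AllPairs S xs
AllPairs-refine refine []         AllPairs.[]           = AllPairs.[]
AllPairs-refine refine (px ∷ pxs) (rx AllPairs.∷ rxs) =
  All.zipWith (λ (py , rxy) → refine px py rxy) (pxs , rx) AllPairs.∷ AllPairs-refine refine pxs rxs

module _ {K : ℕ} (A : List (Fin (suc K))) (sorted : Sorted A) (n : ℕ) where

  canonicalCycles : List (Vec (State (suc K)) (suc n))
  canonicalCycles = map cycleOf (canonicalThrows A n)

  length-canonicalCycles : length canonicalCycles ≡ countCanonical (length A) n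
  length-canonicalCycles = trans (length-map cycleOf (canonicalThrows A n)) (length-canonicalThrows A n sorted)

  canonicalCycles-cycles : All IsCycle canonicalCycles
  canonicalCycles-cycles = All.map⁺ (All.tabulate λ {b} b∈ →
    let (canonical , _ , R≡N) = canonicalThrows-sound A n sorted b∈ in
    cycleOf-isCycle b R≡N (canonical⇒unique-hands b canonical))

  canonicalCycles-inequivalent : AllPairs.AllPairs (λ s s′ → ¬ RotEquiv s s′) canonicalCycles
  canonicalCycles-inequivalent = AllPairs.map⁺ (AllPairs-refine
    (λ (canon , _ , R≡N) (canon′ , _ , R′≡N) b≢b′ rot →
       b≢b′ (sym (canonical-rotation⇒≡ canon canon′ R≡N R′≡N rot)))
    (All.tabulate (canonicalThrows-sound A n sorted)) (canonicalThrows-unique A n sorted))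

  canonicalCycles-complete : (∀ j → j ∈ A) → ∀ s → IsCycle s → Any (RotEquiv s) canonicalCycles
  canonicalCycles-complete ∈A s cyc =
    let (b , canonical , R≡N , rot) = cycle⇒canonical s cyc in
    Any.map⁺ (lose (canonicalThrows-complete A n sorted canonical (λ {j} _ → ∈A j) R≡N) rot)

primeCount : ∀ K n → PrimeCount (suc K) (suc n) (countCanonical (suc K) n)
primeCount K n =
  canonicalCycles A sorted n ,
  trans (length-canonicalCycles A sorted n) (cong (λ j → countCanonical j n) (length-tabulate id)) ,
  canonicalCycles-cycles A sorted n ,
  canonicalCycles-inequivalent A sorted n ,
  canonicalCycles-complete A sorted n ∈-allFin
  where
  A = allFin (suc K)
  sorted = allFin-sorted (suc K)

-- Bounds on the count

binomial-two-terms : ∀ y i → y ^ suc i + suc i * y ^ i ≤ suc y ^ suc i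
binomial-two-terms y zero    = ≤-reflexive (+-comm (y * 1) 1)
binomial-two-terms y (suc i) = begin
  y ^ suc (suc i) + suc (suc i) * y ^ suc i              ≡⟨ expand y (y ^ i) i ⟩
  y * y ^ suc i + (y ^ suc i + suc i * (y * y ^ i))     ≤⟨ +-monoʳ-≤ (y * y ^ suc i) (+-monoʳ-≤ (y ^ suc i)
                                                           (*-monoʳ-≤ (suc i) (*-monoˡ-≤ (y ^ i) (n≤1+n y)))) ⟩
  y * y ^ suc i + (y ^ suc i + suc i * (suc y * y ^ i)) ≡⟨ factor y (y ^ i) i ⟩
  suc y * (y ^ suc i + suc i * y ^ i)                    ≤⟨ *-monoʳ-≤ (suc y) (binomial-two-terms y i) ⟩
  suc y ^ suc (suc i)                                    ∎
  where
  open ≤-Reasoning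
  expand : ∀ y p i → y * (y * p) + suc (suc i) * (y * p) ≡ y * (y * p) + (y * p + suc i * (y * p))
  expand = solve-∀
  factor : ∀ y p i → y * (y * p) + (y * p + suc i * (suc y * p)) ≡ suc y * (y * p + suc i * p)
  factor = solve-∀

1≤countUpTo : ∀ j L → 1 ≤ countUpTo j L
1≤countUpTo j zero    = ≤-refl
1≤countUpTo j (suc L) = ≤-trans (1≤countUpTo j L) (m≤m+n _ _)

countUpTo≤ : ∀ j L → countUpTo j L ≤ suc L ^ j
countUpTo≤ j       zero    = ≤-reflexive (sym (^-zeroˡ j))
countUpTo≤ zero    (suc L) = ≤-trans (≤-reflexive (+-identityʳ _)) (countUpTo≤ zero L)
countUpTo≤ (suc i) (suc L) = begin
  countUpTo (suc i) L + suc i * countUpTo i L ≤⟨ +-mono-≤ (countUpTo≤ (suc i) L)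
                                                           (*-monoʳ-≤ (suc i) (countUpTo≤ i L)) ⟩
  suc L ^ suc i + suc i * suc L ^ i           ≤⟨ binomial-two-terms (suc L) i ⟩
  suc (suc L) ^ suc i                         ∎
  where open ≤-Reasoning

1↓j≤1 : ∀ j → 1 ↓ j ≤ 1
1↓j≤1 zero    = ≤-refl
1↓j≤1 (suc j) = *-mono-≤ (m∸n≤m 1 j) (1↓j≤1 j)

↓≤countUpTo : ∀ j L → suc L ↓ j ≤ countUpTo j L
↓≤countUpTo j       zero    = 1↓j≤1 j
↓≤countUpTo zero    (suc L) = 1≤countUpTo zero (suc L)
↓≤countUpTo (suc j) (suc L) = begin
  suc (suc L) ↓ suc j                         ≡⟨ nP′k≡n[n∸1P′k∸1] (suc (suc L)) (suc j) ⟩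
  suc (suc L) * (suc L ↓ j)                   ≤⟨ *-monoˡ-≤ (suc L ↓ j) (s≤s (m≤n+m∸n (suc L) j)) ⟩
  (suc j + (suc L ∸ j)) * (suc L ↓ j)         ≡⟨ *-distribʳ-+ (suc L ↓ j) (suc j) (suc L ∸ j) ⟩
  suc j * (suc L ↓ j) + suc L ↓ suc j         ≤⟨ +-mono-≤ (*-monoʳ-≤ (suc j) (↓≤countUpTo j L))
                                                          (↓≤countUpTo (suc j) L) ⟩
  suc j * countUpTo j L + countUpTo (suc j) L ≡⟨ +-comm (suc j * countUpTo j L) _ ⟩
  countUpTo (suc j) L + suc j * countUpTo j L ∎
  where open ≤-Reasoning

↓≤^ : ∀ x j → x ↓ j ≤ x ^ j
↓≤^ x zero    = ≤-refl
↓≤^ x (suc j) = *-mono-≤ (m∸n≤m x j) (↓≤^ x j)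

^≤↓+gap : ∀ x j → x * x ^ j ≤ x * (x ↓ j) + j * j * x ^ j
^≤↓+gap x zero    = ≤-reflexive (sym (+-identityʳ (x * 1)))
^≤↓+gap x (suc j) = begin
  x * (x * x ^ j)                                        ≤⟨ *-monoʳ-≤ x (^≤↓+gap x j) ⟩
  x * (x * (x ↓ j) + j * j * x ^ j)                      ≡⟨ distribute x (x ↓ j) j (x ^ j) ⟩
  x * (x * (x ↓ j)) + j * j * (x * x ^ j)                ≤⟨ +-monoˡ-≤ _ (*-monoʳ-≤ x
                                                              (*-monoˡ-≤ (x ↓ j) (m≤n+m∸n x j))) ⟩
  x * ((j + (x ∸ j)) * (x ↓ j)) + j * j * (x * x ^ j)    ≡⟨ split x j (x ∸ j) (x ↓ j) (x * x ^ j) ⟩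
  x * (x ↓ suc j) + j * (x * (x ↓ j)) + j * j * (x * x ^ j) ≤⟨ +-monoˡ-≤ _ (+-monoʳ-≤ (x * (x ↓ suc j))
                                                               (*-monoʳ-≤ j (*-monoʳ-≤ x (↓≤^ x j)))) ⟩
  x * (x ↓ suc j) + j * (x * x ^ j) + j * j * (x * x ^ j) ≡⟨ collect (x * (x ↓ suc j)) j (x * x ^ j) ⟩
  x * (x ↓ suc j) + (j + j * j) * (x * x ^ j)            ≤⟨ +-monoʳ-≤ (x * (x ↓ suc j))
                                                              (*-monoˡ-≤ (x * x ^ j) j+j²≤[1+j]²) ⟩
  x * (x ↓ suc j) + suc j * suc j * (x * x ^ j)          ∎
  where
  open ≤-Reasoning
  distribute : ∀ x p j q → x * (x * p + j * j * q) ≡ x * (x * p) + j * j * (x * q)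
  distribute = solve-∀
  split : ∀ x j d p q → x * ((j + d) * p) + j * j * q ≡ x * (d * p) + j * (x * p) + j * j * q
  split = solve-∀
  collect : ∀ a j q → a + j * q + j * j * q ≡ a + (j + j * j) * q
  collect = solve-∀
  square : ∀ j → j + j * j + suc j ≡ suc j * suc j
  square = solve-∀
  j+j²≤[1+j]² : j + j * j ≤ suc j * suc j
  j+j²≤[1+j]² = ≤-trans (m≤m+n (j + j * j) (suc j)) (≤-reflexive (square j))

countCanonical-upper : ∀ K n {j} → j ≤ K → suc n * countCanonical j n ≤ j * suc n ^ K
countCanonical-upper K n {zero}  _   = ≤-reflexive (*-zeroʳ (suc n))
countCanonical-upper K n {suc j} j<K = begin
  x * (countUpTo j n + countCanonical j n)   ≡⟨ *-distribˡ-+ x (countUpTo j n) (countCanonical j n) ⟩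
  x * countUpTo j n + x * countCanonical j n ≤⟨ +-mono-≤ (*-monoʳ-≤ x (countUpTo≤ j n))
                                                        (countCanonical-upper K n (<⇒≤ j<K)) ⟩
  x ^ suc j + j * x ^ K                      ≤⟨ +-monoˡ-≤ (j * x ^ K) (^-monoʳ-≤ x j<K) ⟩
  x ^ K + j * x ^ K                          ∎
  where
  open ≤-Reasoning
  x = suc n

∣m-n∣≤o : ∀ {m n o} → m ≤ n + o → n ≤ m + o → ∣ m - n ∣ ≤ o
∣m-n∣≤o {m} {n} m≤n+o n≤m+o with ∣m-n∣≡[m∸n]∨[n∸m] m n
... | inj₁ eq = subst (_≤ _) (sym eq) (m≤n+o⇒m∸n≤o m n m≤n+o)
... | inj₂ eq = subst (_≤ _) (sym eq) (m≤n+o⇒m∸n≤o n m n≤m+o)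

countCanonical-gap : ∀ K n → suc n * ∣ countCanonical (suc K) n - suc n ^ K ∣ ≤ (K * K + K) * suc n ^ K
countCanonical-gap K n = begin
  x * ∣ P - g ∣     ≡⟨ *-distribˡ-∣-∣ x P g ⟩
  ∣ x * P - x * g ∣ ≤⟨ ∣m-n∣≤o upper lower ⟩
  (K * K + K) * g   ∎
  where
  open ≤-Reasoning
  x = suc n
  P = countCanonical (suc K) n
  g = x ^ K
  upper : x * P ≤ x * g + (K * K + K) * g
  upper = begin
    x * (countUpTo K n + countCanonical K n)   ≡⟨ *-distribˡ-+ x (countUpTo K n) (countCanonical K n) ⟩
    x * countUpTo K n + x * countCanonical K n ≤⟨ +-mono-≤ (*-monoʳ-≤ x (countUpTo≤ K n))
                                                          (countCanonical-upper K n ≤-refl) ⟩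
    x * g + K * g                              ≤⟨ +-monoʳ-≤ (x * g) (*-monoˡ-≤ g (m≤n+m K (K * K))) ⟩
    x * g + (K * K + K) * g                    ∎
  lower : x * g ≤ x * P + (K * K + K) * g
  lower = begin
    x * g                    ≤⟨ ^≤↓+gap x K ⟩
    x * (x ↓ K) + K * K * g  ≤⟨ +-mono-≤ (*-monoʳ-≤ x (≤-trans (↓≤countUpTo K n) (m≤m+n _ _)))
                                         (*-monoˡ-≤ g (m≤m+n (K * K) K)) ⟩
    x * P + (K * K + K) * g  ∎

scaled-gap : ∀ {N d C g q} → N * d ≤ C * g → C * q < N → 0 < g → d * q < g
scaled-gap {N} {d} {C} {g} {q} Nd≤Cg Cq<N g>0 = *-cancelˡ-< N (d * q) g (begin-strict
  N * (d * q) ≡⟨ *-assoc N d q ⟨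
  N * d * q   ≤⟨ *-monoˡ-≤ q Nd≤Cg ⟩
  C * g * q   ≡⟨ swap C g q ⟩
  C * q * g   <⟨ *-monoˡ-< g {{>-nonZero g>0}} Cq<N ⟩
  N * g       ∎)
  where
  open ≤-Reasoning
  swap : ∀ C g q → C * g * q ≡ C * q * g
  swap = solve-∀

-- A local module: Data.Integer's +_ would clash with the sections of ℕ's _+_ above.
module _ where
  open import Data.Integer as ℤ using (+_; +[1+_]; -[1+_]; +0)
  import Data.Integer.Properties as ℤ
  open import Data.Rational as ℚ using (mkℚ; toℚᵘ)
  import Data.Rational.Properties as ℚP
  import Data.Rational.Unnormalised as ℚᵘ
  import Data.Rational.Unnormalised.Properties as ℚᵘP

  ℕtoℚ≡mkℚ : ∀ a → ℕtoℚ a ≡ mkℚ (+ a) 0 (Coprime.sym (1-coprimeTo a))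
  ℕtoℚ≡mkℚ a = ℚP.normalize-coprime (Coprime.sym (1-coprimeTo a))

  ∣+a*1-+b*1∣≡∣a-b∣ : ∀ a b → ℤ.∣ + a ℤ.* + 1 ℤ.+ (ℤ.- + b) ℤ.* + 1 ∣ ≡ ∣ a - b ∣
  ∣+a*1-+b*1∣≡∣a-b∣ a b = begin
    ℤ.∣ + a ℤ.* + 1 ℤ.+ (ℤ.- + b) ℤ.* + 1 ∣ ≡⟨ cong₂ (λ x y → ℤ.∣ x ℤ.+ y ∣) (ℤ.*-identityʳ (+ a))
                                                                          (ℤ.*-identityʳ (ℤ.- + b)) ⟩
    ℤ.∣ + a ℤ.+ ℤ.- + b ∣                   ≡⟨ cong ℤ.∣_∣ (ℤ.m-n≡m⊖n a b) ⟩
    ℤ.∣ a ℤ.⊖ b ∣                           ≡⟨ ∣⊖∣≡∣-∣ (≤-total a b) ⟩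
    ∣ a - b ∣                               ∎
    where
    open ≡-Reasoning
    ∣⊖∣≡∣-∣ : a ≤ b ⊎ b ≤ a → ℤ.∣ a ℤ.⊖ b ∣ ≡ ∣ a - b ∣
    ∣⊖∣≡∣-∣ (inj₁ a≤b) = trans (ℤ.∣⊖∣-≤ a≤b) (sym (m≤n⇒∣m-n∣≡n∸m a≤b))
    ∣⊖∣≡∣-∣ (inj₂ b≤a) =
      trans (ℤ.∣m⊖n∣≡∣n⊖m∣ a b) (trans (ℤ.∣⊖∣-≤ b≤a) (sym (m≤n⇒∣n-m∣≡n∸m b≤a)))

  ℕtoℚ-gap< : ∀ a b p q .(c : Coprime (suc p) (suc q)) → ∣ a - b ∣ * suc q < suc p * b →
              ℚ.∣ ℕtoℚ a ℚ.- ℕtoℚ b ∣ ℚ.< mkℚ +[1+ p ] q c ℚ.* ℕtoℚ b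
  ℕtoℚ-gap< a b p q c gap rewrite ℕtoℚ≡mkℚ a | ℕtoℚ≡mkℚ b =
    ℚP.toℚᵘ-cancel-< (ℚᵘP.<-respʳ-≃ (ℚᵘP.≃-sym (ℚP.toℚᵘ-homo-* ε B))
      (ℚᵘP.<-respˡ-≃ (ℚᵘP.≃-sym toℚᵘ-∣A-B∣) (ℚᵘ.*<* (subst₂ ℤ._<_ lhs rhs (ℤ.+<+ gap)))))
    where
    ε = mkℚ +[1+ p ] q c
    A = mkℚ (+ a) 0 (Coprime.sym (1-coprimeTo a))
    B = mkℚ (+ b) 0 (Coprime.sym (1-coprimeTo b))
    toℚᵘ-∣A-B∣ : toℚᵘ (ℚ.∣ A ℚ.- B ∣) ℚᵘ.≃ ℚᵘ.∣ toℚᵘ A ℚᵘ.+ ℚᵘ.- toℚᵘ B ∣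
    toℚᵘ-∣A-B∣ = ℚᵘP.≃-trans (ℚP.toℚᵘ-homo-∣-∣ (A ℚ.- B)) (ℚᵘP.∣-∣-cong
      (ℚᵘP.≃-trans (ℚP.toℚᵘ-homo-+ A (ℚ.- B)) (ℚᵘP.+-congʳ (toℚᵘ A) (ℚP.toℚᵘ-homo‿- B))))
    lhs : + (∣ a - b ∣ * suc q) ≡ + ℤ.∣ + a ℤ.* + 1 ℤ.+ (ℤ.- + b) ℤ.* + 1 ∣ ℤ.* + (suc q * 1)
    lhs = trans (cong₂ (λ x y → + (x * y)) (sym (∣+a*1-+b*1∣≡∣a-b∣ a b)) (sym (*-identityʳ (suc q))))
                (ℤ.pos-* (ℤ.∣ + a ℤ.* + 1 ℤ.+ (ℤ.- + b) ℤ.* + 1 ∣) (suc q * 1))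
    rhs : + (suc p * b) ≡ (+[1+ p ] ℤ.* + b) ℤ.* + (1 * 1)
    rhs = trans (cong +_ (sym (*-identityʳ (suc p * b))))
                (trans (ℤ.pos-* (suc p * b) 1) (cong (ℤ._* + 1) (ℤ.pos-* (suc p) b)))

  gap-bound⇒∼ : ∀ C (f g : ℕ → ℕ) → (∀ n → 0 < g (suc n)) →
                (∀ n → suc n * ∣ f (suc n) - g (suc n) ∣ ≤ C * g (suc n)) → f ∼ g
  gap-bound⇒∼ C f g g>0 gap (mkℚ +0       _ _) (ℚ.*<* (ℤ.+<+ ()))
  gap-bound⇒∼ C f g g>0 gap (mkℚ -[1+ _ ] _ _) (ℚ.*<* ())
  gap-bound⇒∼ C f g g>0 gap (mkℚ +[1+ p ] q c) _ = suc (C * suc q) , λ where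
    zero    ()
    (suc n) Cq<N → ℕtoℚ-gap< (f (suc n)) (g (suc n)) p q c
      (<-≤-trans (scaled-gap {C = C} (gap n) Cq<N (g>0 n)) (m≤n*m (g (suc n)) (suc p)))

proposition5p3 : (k : ℕ) → 1 ≤ k →
    Σ (ℕ → ℕ) λ P′ →
      ((n : ℕ) → PrimeCount k (suc n) (P′ (suc n)))
      × (P′ ∼ (λ n → n ^ (k ∸ 1)))
proposition5p3 (suc K) _ =
  P′ , primeCount K , gap-bound⇒∼ (K * K + K) P′ (_^ K) (λ n → m^n>0 (suc n) K) (countCanonical-gap K)
  where
  P′ : ℕ → ℕ
  P′ N = countCanonical (suc K) (ℕ.pred N)
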